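{- Let $(\mathcal R,\leq,r)$ be as in the context. Every semiselective coideal $\mathcal H\subseteq\mathcal R$ is Ramsey, i.e. for every integer $n\ge 2$, every partition $f:\mathcal{AR}_n\to\{0,1\}$ and every $A\in\mathcal H$ there exists $B\in\mathcal H$ with $B\le A$ such that $f$ is constant on $\mathcal{AR}_n(B)$.
   Context: Setting: $\mathcal R$ is a set with a quasi-order $\leq$ and a map $r:\mathbb N\times\mathcal R\to\mathcal{AR}$ onto a set $\mathcal{AR}$; write $r_n(A)=r(n,A)$. Axiom A.1: $r_0(A)=\emptyset$; if $A\neq B$ then $r_n(A)\neq r_n(B)$ for some $n$; if $r_n(A)=r_m(B)$ then $n=m$ and $r_i(A)=r_i(B)$ for $i<n$. $|a|$ is the unique $n$ with $a=r_n(A)$ for some $A$; $\mathcal{AR}_n=\{a:|a|=n\}$; for $B\in\mathcal R$, $\mathcal{AR}_n(B)=\{r_n(C):C\in\mathcal R,\ C\le B\}$. Identifying $A$ with $(r_n(A))_n$, $\mathcal R$ is a closed subset of $\mathcal{AR}^{\mathbb N}$ ($\mathcal{AR}$ discrete, product topology). Notation: $[a,A]=\{B\in\mathcal R:\exists n\,(r_n(B)=a)\ \&\ B\leq A\}$; $[n,A]=[r_n(A),A]$; $\mathcal{AR}\restriction A=\{a:[a,A]\neq\emptyset\}$; $r_n[a,A]=\{r_n(B):B\in[a,A]\}$; $a\sqsubseteq b$ iff $a=r_m(A)$, $b=r_n(A)$ for some $A$ and $m\le n$. Axiom A.2: there is a quasi-order $\leq_{fin}$ on $\mathcal{AR}$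 with $A\le B$ iff $\forall n\exists m\ r_n(A)\le_{fin} r_m(B)$; $\{b:b\le_{fin}a\}$ finite; if $a\le_{fin}b$, $c\sqsubseteq a$ then $c\le_{fin}d$ for some $d\sqsubseteq b$. $\operatorname{depth}_A(a)=\min\{n:a\le_{fin}r_n(A)\}$. Axiom A.3: if $\operatorname{depth}_A(a)=n$ then $[a,B]\ne\emptyset$ for all $B\in[n,A]$, and for all $B\in[a,A]$ there is $A'\in[n,A]$ with $[a,A']\subseteq[a,B]$. Axiom A.4: if $\operatorname{depth}_A(a)=n$ then for every $\mathcal O\subseteq\mathcal{AR}_{|a|+1}$ there is $B\in[n,A]$ with $r_{|a|+1}[a,B]\subseteq\mathcal O$ or $r_{|a|+1}[a,B]\cap\mathcal O=\emptyset$. Coideals: $\mathcal H\restriction A=\{B\in\mathcal H:B\le A\}$. $\mathcal H\subseteq\mathcal R$ is a coideal if (a) $A\in\mathcal H$, $A\le B$ imply $B\in\mathcal H$; (b) for all $A\in\mathcal H$, $a\in\mathcal{AR}\restriction A$: $[a,B]\neq\emptyset$ for all $B\in[\operatorname{depth}_A(a),A]\cap\mathcal H$, and if $B\in\mathcal H\restriction A$ with $[a,B]\ne\emptyset$ there is $A'\in[\operatorname{depth}_A(a),A]\cap\mathcal H$ with $\emptyset\ne[a,A']\subseteq[a,B]$; (c) for all $A\in\mathcal H$, $a\in\mathcal{AR}\restriction A$, $\mathcal O\subseteq\mathcal{AR}_{|a|+1}$ there is $B\in[\operatorname{depth}_A(a),A]\cap\mathcal H$ with $r_{|a|+1}[a,B]\subseteq\mathcal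 O$ or $r_{|a|+1}[a,B]\cap\mathcal O=\emptyset$. $\mathcal D\subseteq\mathcal S\subseteq\mathcal H$: $\mathcal D$ dense open in $\mathcal S$ if every $A\in\mathcal S$ has $B\in\mathcal D$, $B\le A$, and $A\in\mathcal S$, $B\in\mathcal D$, $A\le B$ imply $A\in\mathcal D$. $B$ diagonalizes $(A_a)_{a\in\mathcal{AR}\restriction A}$ if $[a,B]\subseteq[a,A_a]$ for all $a\in\mathcal{AR}\restriction B$; $B$ diagonalizes $(\mathcal D_a)_{a\in\mathcal{AR}\restriction A}$ (each $\mathcal D_a$ dense open in $\mathcal H\cap[\operatorname{depth}_A(a),A]$) if it diagonalizes some $(A_a)$ with $A_a\in\mathcal D_a$. $\mathcal H$ is semiselective if for every $A\in\mathcal H$, every such $(\mathcal D_a)$ and every $B\in\mathcal H\restriction A$ there is $C\in\mathcal H$, $C\le B$, diagonalizing $(\mathcal D_a)$. -}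

module Defs where

open import Data.Nat using (ℕ; zero; suc; _≤_; _<_)
open import Data.Bool using (Bool)
open import Data.Product using (Σ; ∃; ∃-syntax; _×_; _,_; proj₁; proj₂)
open import Data.Sum using (_⊎_)
open import Data.Empty using (⊥)
open import Data.List using (List)
open import Data.List.Membership.Propositional using (_∈_)
open import Relation.Binary.PropositionalEquality using (_≡_; sym; trans)

-- A space (R, ≤, r) satisfying axioms A.1–A.4 (subsets are predicates).
record RamseySpace : Set₁ where
  field
    R   : Set
    AR  : Set
    _≤_ᴿ : R → R → Set
    r   : ℕ → R → AR
    ≤-refl  : ∀ A → A ≤ A ᴿ
    ≤-trans : ∀ {A B C} → A ≤ B ᴿ → B ≤ C ᴿ → A ≤ C ᴿ
    r-onto : ∀ (a : AR) → Σ ℕ λ n → Σ R λ A → r n A ≡ a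
    A1-empty : Σ AR λ e → ∀ A → r 0 A ≡ e
    A1-sep   : ∀ A B → (∀ n → r n A ≡ r n B) → A ≡ B
    A1-len   : ∀ {n m A B} → r n A ≡ r m B → (n ≡ m) × (∀ i → i < n → r i A ≡ r i B)
    -- R is closed in AR^ℕ (product of discrete topologies)
    closed : ∀ (s : ℕ → AR) → (∀ n → Σ R λ A → ∀ i → i < n → r i A ≡ s i)
             → Σ R λ A → ∀ i → r i A ≡ s i
    _≤fin_ : AR → AR → Set
    ≤fin-refl  : ∀ a → a ≤fin a
    ≤fin-trans : ∀ {a b c} → a ≤fin b → b ≤fin c → a ≤fin c
    A2-≤ : ∀ A B → (A ≤ B ᴿ → ∀ n → Σ ℕ λ m → r n A ≤fin r m B)
                 × ((∀ n → Σ ℕ λ m → r n A ≤fin r m B) → A ≤ B ᴿ)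
    A2-finite : ∀ a → Σ (List AR) λ L → ∀ b → b ≤fin a → b ∈ L

  _⊑_ : AR → AR → Set
  a ⊑ b = Σ R λ A → Σ ℕ λ m → Σ ℕ λ n → (m ≤ n) × (a ≡ r m A) × (b ≡ r n A)

  _∈[_,_] : R → AR → R → Set
  B ∈[ a , A ] = (Σ ℕ λ n → r n B ≡ a) × B ≤ A ᴿ

  NonEmpty[_,_] : AR → R → Set
  NonEmpty[ a , A ] = Σ R λ B → B ∈[ a , A ]

  _⊆[_]_ : R → AR → R → Set
  A ⊆[ a ] B = ∀ C → C ∈[ a , A ] → C ∈[ a , B ]

  _∈AR↾_ : AR → R → Set
  a ∈AR↾ A = NonEmpty[ a , A ]

  ∣_∣ : AR → ℕ
  ∣ a ∣ = proj₁ (r-onto a)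

  ARₙ : ℕ → Set
  ARₙ n = Σ AR λ a → ∣ a ∣ ≡ n

  Depth : R → AR → ℕ → Set
  Depth A a n = (a ≤fin r n A) × (∀ m → a ≤fin r m A → n ≤ m)

  r⁺⊆ : AR → R → (AR → Set) → Set
  r⁺⊆ a B 𝒪 = ∀ C → C ∈[ a , B ] → 𝒪 (r (suc ∣ a ∣) C)

  r⁺∩∅ : AR → R → (AR → Set) → Set
  r⁺∩∅ a B 𝒪 = ∀ C → C ∈[ a , B ] → 𝒪 (r (suc ∣ a ∣) C) → ⊥

  SubsetOf : ℕ → (AR → Set) → Set
  SubsetOf k 𝒪 = ∀ b → 𝒪 b → ∣ b ∣ ≡ k

  field
    A2-⊑ : ∀ {a b c} → a ≤fin b → c ⊑ a → Σ AR λ d → (d ⊑ b) × (c ≤fin d)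
    A3-nonempty : ∀ A a n → Depth A a n → ∀ B → B ∈[ r n A , A ] → NonEmpty[ a , B ]
    A3-shrink   : ∀ A a n → Depth A a n → ∀ B → B ∈[ a , A ]
                  → Σ R λ A' → A' ∈[ r n A , A ] × A' ⊆[ a ] B
    A4 : ∀ A a n → Depth A a n → ∀ (𝒪 : AR → Set) → SubsetOf (suc ∣ a ∣) 𝒪
         → Σ R λ B → B ∈[ r n A , A ] × (r⁺⊆ a B 𝒪 ⊎ r⁺∩∅ a B 𝒪)

module _ (S : RamseySpace) where
  open RamseySpace S

  ∣r∣ : ∀ n A → ∣ r n A ∣ ≡ n
  ∣r∣ n A with r-onto (r n A)
  ... | m , B , eq = proj₁ (A1-len eq)

  rₙ : ∀ n → R → ARₙ n
  rₙ n C = r n C , ∣r∣ n C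

  IsCoideal : (R → Set) → Set₁
  IsCoideal H =
      (∀ A B → H A → A ≤ B ᴿ → H B)
    × (∀ A a → H A → a ∈AR↾ A → ∀ n → Depth A a n →
          (∀ B → B ∈[ r n A , A ] → H B → NonEmpty[ a , B ])
        × (∀ B → H B → B ≤ A ᴿ → NonEmpty[ a , B ] →
             Σ R λ A' → A' ∈[ r n A , A ] × H A' × NonEmpty[ a , A' ] × A' ⊆[ a ] B))
    × (∀ A a → H A → a ∈AR↾ A → ∀ n → Depth A a n →
         ∀ (𝒪 : AR → Set) → SubsetOf (suc ∣ a ∣) 𝒪 →
         Σ R λ B → B ∈[ r n A , A ] × H B × (r⁺⊆ a B 𝒪 ⊎ r⁺∩∅ a B 𝒪))

  DenseOpenIn : (R → Set) → (R → Set) → Set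
  DenseOpenIn 𝒟 𝒮 =
      (∀ A → 𝒟 A → 𝒮 A)
    × (∀ A → 𝒮 A → Σ R λ B → 𝒟 B × B ≤ A ᴿ)
    × (∀ A B → 𝒮 A → 𝒟 B → A ≤ B ᴿ → 𝒟 A)

  DiagonalizesSeq : R → (AR → R) → Set
  DiagonalizesSeq B Aₐ = ∀ a → a ∈AR↾ B → B ⊆[ a ] (Aₐ a)

  DiagonalizesDense : R → R → (AR → R → Set) → Set
  DiagonalizesDense A B 𝒟 =
    Σ (AR → R) λ Aₐ → (∀ a → a ∈AR↾ A → 𝒟 a (Aₐ a)) × DiagonalizesSeq B Aₐ

  IsSemiselective : (R → Set) → Set₁
  IsSemiselective H =
    ∀ A → H A → ∀ (𝒟 : AR → R → Set) →
      (∀ a → a ∈AR↾ A → ∀ n → Depth A a n →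
         DenseOpenIn (𝒟 a) (λ X → H X × X ∈[ r n A , A ])) →
      ∀ B → H B → B ≤ A ᴿ →
      Σ R λ C → H C × C ≤ B ᴿ × DiagonalizesDense A C 𝒟

  IsRamsey : (R → Set) → Set
  IsRamsey H =
    ∀ (n : ℕ) → 2 ≤ n → ∀ (f : ARₙ n → Bool) → ∀ A → H A →
      Σ R λ B → H B × B ≤ A ᴿ × Σ Bool λ i → ∀ C → C ≤ B ᴿ → f (rₙ n C) ≡ i

module Submission where

open import Defs
open import Data.Nat using (ℕ; zero; suc; _<_; _<?_; z≤n)
open import Data.Nat.Properties using (≤-antisym; <⇒≱; ≮⇒≥; ≡-irrelevant)
open import Data.Bool using (Bool; true)
open import Data.Bool.Properties using (¬-not)
open import Data.Product using (Σ; _×_; _,_; proj₁; proj₂)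
open import Data.Sum using (_⊎_; inj₁; inj₂)
open import Relation.Nullary using (¬_; yes; no; contradiction)
open import Relation.Binary.PropositionalEquality using (_≡_; refl; sym; trans; subst; cong)

-- Induction on the level k: colour the (k+1)-approximations by P. Semiselectivity yields
-- C ∈ H such that, for every a of length k, P is already decided on all one-step
-- extensions of a inside C; colouring a by "all its extensions in C satisfy P" and
-- applying the induction hypothesis one level down gives a homogeneous B ≤ C.

module RamseySpaceFacts (S : RamseySpace) where
  open RamseySpace S

  ∈[r]⇒r≡ : ∀ {X m A} → X ∈[ r m A , A ] → r m X ≡ r m A
  ∈[r]⇒r≡ {X} {m} ((k , e) , _) = subst (λ k → r k X ≡ r m _) (proj₁ (A1-len e)) e

  ∈[r]⇒r<≡ : ∀ {X m A} → X ∈[ r m A , A ] → ∀ i → i < m → r i X ≡ r i A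
  ∈[r]⇒r<≡ ((k , e) , _) i i<m = proj₂ (A1-len e) i (subst (i <_) (sym (proj₁ (A1-len e))) i<m)

  ∈[r]-trans : ∀ {B X A m} → B ∈[ r m X , X ] → X ∈[ r m A , A ] → B ∈[ r m A , A ]
  ∈[r]-trans ((j , e) , B≤X) X∈ = (j , trans e (∈[r]⇒r≡ X∈)) , ≤-trans B≤X (proj₂ X∈)

  ≤⇒⊆[] : ∀ {a Y Z} → Y ≤ Z ᴿ → Y ⊆[ a ] Z
  ≤⇒⊆[] Y≤Z C (C∈ , C≤Y) = C∈ , ≤-trans C≤Y Y≤Z

  ≤⇒∈[r] : ∀ n {E X} → E ≤ X ᴿ → E ∈[ r n E , X ]
  ≤⇒∈[r] n E≤X = (n , refl) , E≤X

  ∈AR↾-≤ : ∀ {a C A} → C ≤ A ᴿ → a ∈AR↾ C → a ∈AR↾ A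
  ∈AR↾-≤ C≤A (E , E∈ , E≤C) = E , E∈ , ≤-trans E≤C C≤A

  r₀-const : ∀ C A → r 0 C ≡ r 0 A
  r₀-const C A = trans (proj₂ A1-empty C) (sym (proj₂ A1-empty A))

  r-suc-∣r∣ : ∀ n A C → r (suc ∣ r n A ∣) C ≡ r (suc n) C
  r-suc-∣r∣ n A C = cong (λ j → r (suc j) C) (∣r∣ S n A)

  Depth-unique : ∀ {A a d m} → Depth A a d → Depth A a m → d ≡ m
  Depth-unique {d = d} {m} (a≤d , d-min) (a≤m , m-min) = ≤-antisym (d-min m a≤m) (m-min d a≤d)

  Depth-r₀ : ∀ A → Depth A (r 0 A) 0
  Depth-r₀ A = ≤fin-refl _ , λ _ _ → z≤n

  -- The approximations of X and A agree below m, so no shallower witness appears in X.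
  Depth-∈[r] : ∀ {A a m X} → Depth A a m → X ∈[ r m A , A ] → Depth X a m
  Depth-∈[r] {a = a} {m} {X} (a≤m , m-min) X∈ = subst (a ≤fin_) (sym (∈[r]⇒r≡ X∈)) a≤m , X-min
    where
    X-min : ∀ j → a ≤fin r j X → m Data.Nat.≤ j
    X-min j a≤j with j <? m
    ... | yes j<m = contradiction (m-min j (subst (a ≤fin_) (∈[r]⇒r<≡ X∈ j j<m) a≤j)) (<⇒≱ j<m)
    ... | no j≮m = ≮⇒≥ j≮m

  _∈[depth_,_] : R → AR → R → Set
  X ∈[depth a , A ] = Σ ℕ λ d → Depth A a d × X ∈[ r d A , A ]

  ∈[depth]⇒∈[r] : ∀ {A a m X} → Depth A a m → X ∈[depth a , A ] → X ∈[ r m A , A ]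
  ∈[depth]⇒∈[r] {A} {X = X} dep (d , dep′ , X∈) =
    subst (λ d → X ∈[ r d A , A ]) (Depth-unique dep′ dep) X∈

  OneStep : AR → (AR → Set) → AR → Set
  OneStep a P b = ∣ b ∣ ≡ suc ∣ a ∣ × P b

  OneStep-subset : ∀ a P → SubsetOf (suc ∣ a ∣) (OneStep a P)
  OneStep-subset a P b = proj₁

  Decides : AR → R → (AR → Set) → Set
  Decides a X P = r⁺⊆ a X (OneStep a P) ⊎ r⁺∩∅ a X (OneStep a P)

  Decides-⊆ : ∀ {a X Y P} → X ⊆[ a ] Y → Decides a Y P → Decides a X P
  Decides-⊆ X⊆Y (inj₁ all)  = inj₁ λ C C∈ → all C (X⊆Y C C∈)
  Decides-⊆ X⊆Y (inj₂ none) = inj₂ λ C C∈ → none C (X⊆Y C C∈)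

  Homogeneous : ℕ → (AR → Set) → R → Set
  Homogeneous n P B = (∀ C → C ≤ B ᴿ → P (r n C)) ⊎ (∀ C → C ≤ B ᴿ → ¬ P (r n C))

module Ramsey (S : RamseySpace) (H : RamseySpace.R S → Set)
              (coideal : IsCoideal S H) (semiselective : IsSemiselective S H) where
  open RamseySpace S
  open RamseySpaceFacts S

  RamseyAt : ℕ → Set₁
  RamseyAt n = ∀ (P : AR → Set) A → H A → Σ R λ B → H B × B ≤ A ᴿ × Homogeneous n P B

  coideal-nonempty : ∀ A a → H A → a ∈AR↾ A → ∀ m → Depth A a m →
                     ∀ B → B ∈[ r m A , A ] → H B → NonEmpty[ a , B ]
  coideal-nonempty A a HA a∈ m dep = proj₁ (proj₁ (proj₂ coideal) A a HA a∈ m dep)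

  coideal-decides : ∀ P X a m → H X → a ∈AR↾ X → Depth X a m →
                    Σ R λ B → B ∈[ r m X , X ] × H B × Decides a B P
  coideal-decides P X a m HX a∈ dep =
    proj₂ (proj₂ coideal) X a HX a∈ m dep (OneStep a P) (OneStep-subset a P)

  -- Level 0 would need excluded middle for P (r 0 A), so the induction starts at level 1.
  ramseyAt-1 : RamseyAt 1
  ramseyAt-1 P A HA with coideal-decides P A (r 0 A) 0 HA (A , ≤⇒∈[r] 0 (≤-refl A)) (Depth-r₀ A)
  ... | B , (_ , B≤A) , HB , decided = B , HB , B≤A , homogeneous decided
    where
    in[r₀A,B] : ∀ C → C ≤ B ᴿ → C ∈[ r 0 A , B ]
    in[r₀A,B] C C≤B = (0 , r₀-const C A) , C≤B
    homogeneous : Decides (r 0 A) B P → Homogeneous 1 P B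
    homogeneous (inj₁ all) = inj₁ λ C C≤B →
      subst P (r-suc-∣r∣ 0 A C) (proj₂ (all C (in[r₀A,B] C C≤B)))
    homogeneous (inj₂ none) = inj₂ λ C C≤B p →
      none C (in[r₀A,B] C C≤B) (∣r∣ S _ C , subst P (sym (r-suc-∣r∣ 0 A C)) p)

  decided-below : ∀ P A → H A →
                  Σ R λ C → H C × C ≤ A ᴿ × (∀ a → a ∈AR↾ C → Decides a C P)
  decided-below P A HA = C , HC , C≤A , λ a a∈C →
      Decides-⊆ {P = P} (diagonal a a∈C) (proj₂ (proj₂ (in𝒟 a (∈AR↾-≤ C≤A a∈C))))
    where
    𝒟 : AR → R → Set
    𝒟 a X = H X × X ∈[depth a , A ] × Decides a X P
    dense : ∀ a → a ∈AR↾ A → ∀ m → Depth A a m →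
            DenseOpenIn S (𝒟 a) (λ X → H X × X ∈[ r m A , A ])
    dense a a∈ m dep = (λ X (HX , X∈ , _) → HX , ∈[depth]⇒∈[r] dep X∈) , below , open′
      where
      below : ∀ X → H X × X ∈[ r m A , A ] → Σ R λ B → 𝒟 a B × B ≤ X ᴿ
      below X (HX , X∈) with coideal-decides P X a m HX
                               (coideal-nonempty A a HA a∈ m dep X X∈ HX) (Depth-∈[r] dep X∈)
      ... | B , B∈ , HB , decided = B , (HB , (m , dep , ∈[r]-trans B∈ X∈) , decided) , proj₂ B∈
      open′ : ∀ Y Z → H Y × Y ∈[ r m A , A ] → 𝒟 a Z → Y ≤ Z ᴿ → 𝒟 a Y
      open′ Y Z (HY , Y∈) (_ , _ , decided) Y≤Z = HY , (m , dep , Y∈) , Decides-⊆ {P = P} (≤⇒⊆[] Y≤Z) decided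
    diagonalizer = semiselective A HA 𝒟 dense A HA (≤-refl A)
    C = proj₁ diagonalizer
    HC = proj₁ (proj₂ diagonalizer)
    C≤A = proj₁ (proj₂ (proj₂ diagonalizer))
    in𝒟 = proj₁ (proj₂ (proj₂ (proj₂ (proj₂ diagonalizer))))
    diagonal = proj₂ (proj₂ (proj₂ (proj₂ (proj₂ diagonalizer))))

  ramseyAt-suc : ∀ n → RamseyAt n → RamseyAt (suc n)
  ramseyAt-suc n ramseyAt-n P A HA with decided-below P A HA
  ... | C , HC , C≤A , decided with ramseyAt-n (λ a → r⁺⊆ a C (OneStep a P)) C HC
  ...   | B , HB , B≤C , inj₁ all  = B , HB , ≤-trans B≤C C≤A , inj₁ λ E E≤B →
            subst P (r-suc-∣r∣ n E E) (proj₂ (all E E≤B E (≤⇒∈[r] n (≤-trans E≤B B≤C))))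
  ...   | B , HB , B≤C , inj₂ none = B , HB , ≤-trans B≤C C≤A , inj₂ λ E E≤B →
            let E∈ = ≤⇒∈[r] n (≤-trans E≤B B≤C)
            in excluded E (none E E≤B) (decided (r n E) (E , E∈)) E∈
    where
    excluded : ∀ E → ¬ r⁺⊆ (r n E) C (OneStep (r n E) P) → Decides (r n E) C P →
               E ∈[ r n E , C ] → ¬ P (r (suc n) E)
    excluded E ¬all (inj₁ all)  _  _ = ¬all all
    excluded E _    (inj₂ none) E∈ p = none E E∈ (∣r∣ S _ E , subst P (sym (r-suc-∣r∣ n E E)) p)

  ramseyAt : ∀ k → RamseyAt (suc k)
  ramseyAt zero    = ramseyAt-1
  ramseyAt (suc k) = ramseyAt-suc (suc k) (ramseyAt k)

  partition-homogeneous : ∀ k (f : ARₙ (suc k) → Bool) A → H A →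
                          Σ R λ B → H B × B ≤ A ᴿ × Σ Bool λ i → ∀ C → C ≤ B ᴿ → f (rₙ S (suc k) C) ≡ i
  partition-homogeneous k f A HA with ramseyAt k (λ b → Σ (∣ b ∣ ≡ suc k) λ p → f (b , p) ≡ true) A HA
  ... | B , HB , B≤A , inj₁ all  = B , HB , B≤A , true , λ C C≤B →
        let (p , fp≡true) = all C C≤B
        in subst (λ q → f (r (suc k) C , q) ≡ true) (≡-irrelevant p (∣r∣ S _ C)) fp≡true
  ... | B , HB , B≤A , inj₂ none = B , HB , B≤A , _ , λ C C≤B →
        ¬-not λ f≡true → none C C≤B (∣r∣ S _ C , f≡true)

theorem3p19 : (S : RamseySpace) → (H : RamseySpace.R S → Set) → IsCoideal S H → IsSemiselective S H → IsRamsey S H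
theorem3p19 S H coideal semiselective zero    ()
theorem3p19 S H coideal semiselective (suc k) _ = Ramsey.partition-homogeneous S H coideal semiselective k
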